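{- Let $T$ be a nice triple and define $T_0=T$, $T_{k+1}=T_k\otimes T_k$ for $k\geqslant 0$. Then for every $k\geqslant 0$: (1) $\alpha(T_k)=\alpha(T)+k$; (2) $\beta(T_k)=2^k\beta(T)+2^k-1$; (3) $\delta(T_k)=2^k\beta(T)+\alpha(T)+2^k+k-1=2^k\delta(T)-(2^k-1)\alpha(T)+2^k+k-1$; (4) $g(T_k)=2^k g(T)$; (5) $n(T_k)=2^k n(T)+\frac{4^k-2^k}{2}g(T)^2$. Moreover, if $g(T)=\beta(T)+1$, then $g(T_k)=\beta(T_k)+1$ for every $k\geqslant 0$.
   Context: Let $S=\{0,1,*\}$; elements of $S^d$ are strings of length $d$. For $u,v\in S^d$ let $\mathrm{dist}(u,v)$ be the number of positions $i$ with $u_i\neq v_i$ and $u_i,v_i\in\{0,1\}$. A list is a finite sequence of strings all of the same length (repetitions allowed); $|L|$ is its number of entries; $[x]$ is the one-entry list of the string $x$; $*^m$ is the string of $m$ jokers $*$. A list $[v_1,\dots,v_n]$ is $k$-neighborly if $1\leqslant\mathrm{dist}(v_i,v_j)\leqslant k$ for all $i\neq j$; a sublist is obtained by deleting entries. Operations: pairing $[v_1,\dots,v_n]\ominus[w_1,\dots,w_n]=[v_1w_1,\dots,v_nw_n]$; concatenation $AB=[v_iw_j]$ (all pairs, ordered lexicographically in $(i,j)$); sum $A+B$ = entries of $A$ followed by entries of $B$; $1\cdot A=A$, $(k+1)\cdot A=k\cdot A+A$; concatenation before sum. A triple $T=(A,B,C)$ of lists is nice if: (1) $\mathrm{dist}(u,v)\leqslant1$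 for all entries $u,v$ of $A$; (2) $|A|=|B|$ and $A\ominus B$ is $2$-neighborly; (3) $C$ is a $1$-neighborly sublist of $B$ and $\mathrm{dist}(u,v)\leqslant 1$ for all entries $u$ of $B$, $v$ of $C$. $\alpha(T)$, $\beta(T)$ are the lengths of the strings in $A$, $B$; $\delta(T)=\alpha(T)+\beta(T)$; $n(T)=|A|$; $g(T)=|C|$. Triples $T=(A,B,C)$, $T'=(A',B',C')$ are concordant if $\alpha(T)=\alpha(T')$ and $\mathrm{dist}(u,v)\leqslant1$ for all entries $u,v$ of $A+A'$ (a nice triple is concordant with itself). Their compound is $T\otimes T'=(A'',B'',C'')$ with $A''=[0]A+[0]A'+[1]\big((g(T)g(T'))\cdot[*^{\alpha(T)}]\big)$, $B''=[0]B[*^{\beta(T')}]+[1][*^{\beta(T)}]B'+[*]CC'$, $C''=[0]C[*^{\beta(T')}]+[1][*^{\beta(T)}]C'$. -}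

module Defs where

open import Data.Nat using (ℕ; zero; suc; _+_; _*_; _≤_)
open import Data.Fin using (Fin)
open import Data.Vec using (Vec; []; _∷_; _++_; replicate)
open import Data.List using (List; length; map; concatMap; concat; zipWith)
import Data.List as L
open import Data.List.Membership.Propositional using (_∈_)
open import Data.List.Relation.Binary.Sublist.Propositional using (_⊆_)
open import Data.Product using (_×_)
open import Relation.Binary.PropositionalEquality using (_≡_; _≢_; refl; subst)

data S : Set where
  𝟘 𝟙 ⋆ : S

differ : S → S → ℕ
differ 𝟘 𝟙 = 1
differ 𝟙 𝟘 = 1
differ _ _ = 0

dist : ∀ {d} → Vec S d → Vec S d → ℕ
dist [] [] = 0
dist (x ∷ u) (y ∷ v) = differ x y + dist u v

Lst : ℕ → Set
Lst d = List (Vec S d)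

stars : (m : ℕ) → Vec S m
stars m = replicate m ⋆

single : ∀ {d} → Vec S d → Lst d
single x = x L.∷ L.[]

-- pairing A ⊖ B (used only when |A| = |B|)
_⊖_ : ∀ {d e} → Lst d → Lst e → Lst (d + e)
A ⊖ B = zipWith _++_ A B

infixr 6 _·_
_·_ : ∀ {d e} → Lst d → Lst e → Lst (d + e)
A · B = concatMap (λ v → map (v ++_) B) A

_times_ : ∀ {d} → ℕ → Lst d → Lst d
m times A = concat (L.replicate m A)

Neighborly : ∀ {d} → ℕ → Lst d → Set
Neighborly k L = (i j : Fin (length L)) → i ≢ j →
  (1 ≤ dist (L.lookup L i) (L.lookup L j)) × (dist (L.lookup L i) (L.lookup L j) ≤ k)

record Triple : Set where
  constructor triple
  field
    α β : ℕ
    A : Lst α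
    B : Lst β
    C : Lst β
open Triple public

δ : Triple → ℕ
δ T = α T + β T

n : Triple → ℕ
n T = length (A T)

g : Triple → ℕ
g T = length (C T)

Nice : Triple → Set
Nice T =
  (∀ {u v} → u ∈ A T → v ∈ A T → dist u v ≤ 1)
  × (length (A T) ≡ length (B T) × Neighborly 2 (A T ⊖ B T))
  × (C T ⊆ B T × Neighborly 1 (C T)
     × (∀ {u v} → u ∈ B T → v ∈ C T → dist u v ≤ 1))

-- compound T ⊗ T' (defined when α(T) = α(T')); string lengths:
-- [0]A : 1+α, [0]B[*^β'] : 1+β+β', [1][*^β]B' : 1+β+β', [*]CC' : 1+β+β'
compound : (T T' : Triple) → α T ≡ α T' → Triple
compound (triple a b A B C) (triple .a b' A' B' C') refl =
  triple (suc a) (suc (b + b'))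
    (single (𝟘 ∷ []) · A  L.++  single (𝟘 ∷ []) · A'
       L.++ single (𝟙 ∷ []) · ((length C * length C') times single (stars a)))
    ((single (𝟘 ∷ []) · B) · single (stars b')
       L.++ (single (𝟙 ∷ []) · single (stars b)) · B'
       L.++ (single (⋆ ∷ []) · C) · C')
    ((single (𝟘 ∷ []) · C) · single (stars b')
       L.++ (single (𝟙 ∷ []) · single (stars b)) · C')

iter : Triple → ℕ → Triple
iter T zero = T
iter T (suc k) = compound (iter T k) (iter T k) refl

{-# OPTIONS --safe #-}
-- Only the lengths of the lists matter, and they obey simple recursions read off
-- the definition of ⊗: α(T ⊗ T') = α + 1, β(T ⊗ T') = β + β' + 1, g(T ⊗ T') = g + g'
-- and n(T ⊗ T') = n + n' + g g'.  Hence along T_{k+1} = T_k ⊗ T_k the quantities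
-- β + 1 and g double, while n_{k+1} = 2 n_k + 4^k g², whose solution is
-- n_k = 2^k n + c_k g² with c_0 = 0, c_{k+1} = 2 c_k + 4^k, i.e. 2 c_k + 2^k = 4^k.
module Submission where

open import Defs
open import Data.Nat using (ℕ; zero; suc; _+_; _*_; _∸_; _^_; _/_; NonZero)
open import Data.Nat.Properties
  using (+-identityʳ; +-suc; +-comm; *-comm; *-identityˡ; *-identityʳ; *-suc; *-distribʳ-+;
         [m*n]*[o*p]≡[m*o]*[n*p]; m+n∸n≡m; m^n≢0)
open import Data.Nat.DivMod using (m*n/n≡m)
open import Data.Nat.Tactic.RingSolver using (solve-∀)
open import Data.Product using (_×_; _,_)
open import Data.List using (length; map)
import Data.List as L
import Data.Vec as V
open import Data.List.Properties using (length-++; length-map)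
open import Relation.Binary.PropositionalEquality using (_≡_; refl; sym; trans; cong; cong₂; module ≡-Reasoning)
open ≡-Reasoning

length-· : ∀ {d e} (A : Lst d) (B : Lst e) → length (A · B) ≡ length A * length B
length-· L.[] B = refl
length-· (v L.∷ A) B = begin
  length (map (v V.++_) B L.++ A · B)        ≡⟨ length-++ (map (v V.++_) B) ⟩
  length (map (v V.++_) B) + length (A · B)  ≡⟨ cong₂ _+_ (length-map (v V.++_) B) (length-· A B) ⟩
  length B + length A * length B             ∎

length-single-· : ∀ {d e} (x : V.Vec S d) (A : Lst e) → length (single x · A) ≡ length A
length-single-· x A = trans (length-· (single x) A) (*-identityˡ (length A))

length-·-single : ∀ {d e} (A : Lst d) (x : V.Vec S e) → length (A · single x) ≡ length A
length-·-single A x = trans (length-· A (single x)) (*-identityʳ (length A))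

length-times : ∀ {d} m (A : Lst d) → length (m times A) ≡ m * length A
length-times zero    A = refl
length-times (suc m) A = trans (length-++ A) (cong (length A +_) (length-times m A))

x₀ x₁ : V.Vec S 1
x₀ = 𝟘 V.∷ V.[]
x₁ = 𝟙 V.∷ V.[]

α-compound : ∀ T T' (e : α T ≡ α T') → α (compound T T' e) ≡ suc (α T)
α-compound (triple a b A B C) (triple .a b' A' B' C') refl = refl

β-compound : ∀ T T' (e : α T ≡ α T') → β (compound T T' e) ≡ suc (β T + β T')
β-compound (triple a b A B C) (triple .a b' A' B' C') refl = refl

g-compound : ∀ T T' (e : α T ≡ α T') → g (compound T T' e) ≡ g T + g T'
g-compound (triple a b A B C) (triple .a b' A' B' C') refl = begin
  length (C₀ L.++ C₁)      ≡⟨ length-++ C₀ ⟩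
  length C₀ + length C₁    ≡⟨ cong₂ _+_ (trans (length-·-single (single x₀ · C) (stars b')) (length-single-· x₀ C))
                                        (trans (length-· (single x₁ · single (stars b)) C')
                                               (cong (_* length C') (length-single-· x₁ (single (stars b))))) ⟩
  length C + 1 * length C' ≡⟨ cong (length C +_) (*-identityˡ (length C')) ⟩
  length C + length C'     ∎
  where
  C₀ C₁ : Lst (suc (b + b'))
  C₀ = (single x₀ · C) · single (stars b')
  C₁ = (single x₁ · single (stars b)) · C'

n-compound : ∀ T T' (e : α T ≡ α T') → n (compound T T' e) ≡ n T + (n T' + g T * g T')
n-compound (triple a b A B C) (triple .a b' A' B' C') refl = begin
  length (single x₀ · A L.++ single x₀ · A' L.++ single x₁ · J)
    ≡⟨ length-++ (single x₀ · A) ⟩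
  length (single x₀ · A) + length (single x₀ · A' L.++ single x₁ · J)
    ≡⟨ cong (length (single x₀ · A) +_) (length-++ (single x₀ · A')) ⟩
  length (single x₀ · A) + (length (single x₀ · A') + length (single x₁ · J))
    ≡⟨ cong₂ _+_ (length-single-· x₀ A) (cong₂ _+_ (length-single-· x₀ A') (length-single-· x₁ J)) ⟩
  length A + (length A' + length J)
    ≡⟨ cong (λ j → length A + (length A' + j)) (trans (length-times (length C * length C') _) (*-identityʳ _)) ⟩
  length A + (length A' + length C * length C') ∎
  where
  J : Lst a
  J = (length C * length C') times single (stars a)

[m*n]^o≡m^o*n^o : ∀ m n o → (m * n) ^ o ≡ m ^ o * n ^ o
[m*n]^o≡m^o*n^o m n zero    = refl
[m*n]^o≡m^o*n^o m n (suc o) = begin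
  m * n * (m * n) ^ o     ≡⟨ cong (m * n *_) ([m*n]^o≡m^o*n^o m n o) ⟩
  m * n * (m ^ o * n ^ o) ≡⟨ [m*n]*[o*p]≡[m*o]*[n*p] m n (m ^ o) (n ^ o) ⟩
  m * m ^ o * (n * n ^ o) ∎

m*[n+o]∸[m∸1]*n≡m*o+n : ∀ m n o .{{_ : NonZero m}} → m * (n + o) ∸ (m ∸ 1) * n ≡ m * o + n
m*[n+o]∸[m∸1]*n≡m*o+n (suc q) n o = begin
  suc q * (n + o) ∸ q * n         ≡⟨ cong (_∸ q * n) (split q n o) ⟩
  suc q * o + n + q * n ∸ q * n   ≡⟨ m+n∸n≡m (suc q * o + n) (q * n) ⟩
  suc q * o + n                   ∎
  where
  split : ∀ q n o → (1 + q) * (n + o) ≡ (1 + q) * o + n + q * n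
  split = solve-∀

m*n+m*n≡2*m*n : ∀ m n → m * n + m * n ≡ 2 * m * n
m*n+m*n≡2*m*n = solve-∀

-- pairs k = (2^k choose 2) = (4^k − 2^k)/2, by a recursion free of truncated
-- subtraction and division.
pairs : ℕ → ℕ
pairs zero    = 0
pairs (suc k) = 2 * pairs k + 4 ^ k

2*pairs+2^k≡4^k : ∀ k → 2 * pairs k + 2 ^ k ≡ 4 ^ k
2*pairs+2^k≡4^k zero    = refl
2*pairs+2^k≡4^k (suc k) = begin
  2 * (2 * pairs k + 4 ^ k) + 2 * 2 ^ k ≡⟨ swap (pairs k) (2 ^ k) (4 ^ k) ⟩
  2 * (2 * pairs k + 2 ^ k) + 2 * 4 ^ k ≡⟨ cong (λ x → 2 * x + 2 * 4 ^ k) (2*pairs+2^k≡4^k k) ⟩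
  2 * 4 ^ k + 2 * 4 ^ k                 ≡⟨ sym (*-distribʳ-+ (4 ^ k) 2 2) ⟩
  4 * 4 ^ k                             ∎
  where
  swap : ∀ c p f → 2 * (2 * c + f) + 2 * p ≡ 2 * (2 * c + p) + 2 * f
  swap = solve-∀

pairs≡[4^k∸2^k]/2 : ∀ k → pairs k ≡ (4 ^ k ∸ 2 ^ k) / 2
pairs≡[4^k∸2^k]/2 k = sym (begin
  (4 ^ k ∸ 2 ^ k) / 2                 ≡⟨ cong (λ x → (x ∸ 2 ^ k) / 2) (sym (2*pairs+2^k≡4^k k)) ⟩
  (2 * pairs k + 2 ^ k ∸ 2 ^ k) / 2   ≡⟨ cong (_/ 2) (m+n∸n≡m (2 * pairs k) (2 ^ k)) ⟩
  2 * pairs k / 2                     ≡⟨ cong (_/ 2) (*-comm 2 (pairs k)) ⟩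
  pairs k * 2 / 2                     ≡⟨ m*n/n≡m (pairs k) 2 ⟩
  pairs k                             ∎)

module _ (T : Triple) where

  α-iter : ∀ k → α (iter T k) ≡ α T + k
  α-iter zero    = sym (+-identityʳ (α T))
  α-iter (suc k) = trans (α-compound (iter T k) (iter T k) refl)
                         (trans (cong suc (α-iter k)) (sym (+-suc (α T) k)))

  suc-β-iter : ∀ k → suc (β (iter T k)) ≡ 2 ^ k * suc (β T)
  suc-β-iter zero    = sym (*-identityˡ (suc (β T)))
  suc-β-iter (suc k) = begin
    suc (β (iter T (suc k)))                ≡⟨ cong suc (β-compound (iter T k) (iter T k) refl) ⟩
    suc (suc (β (iter T k) + β (iter T k))) ≡⟨ cong suc (sym (+-suc (β (iter T k)) (β (iter T k)))) ⟩
    suc (β (iter T k)) + suc (β (iter T k)) ≡⟨ cong₂ _+_ (suc-β-iter k) (suc-β-iter k) ⟩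
    2 ^ k * suc (β T) + 2 ^ k * suc (β T)   ≡⟨ m*n+m*n≡2*m*n (2 ^ k) (suc (β T)) ⟩
    2 ^ suc k * suc (β T)                   ∎

  suc-δ-iter : ∀ k → suc (δ (iter T k)) ≡ 2 ^ k * β T + α T + 2 ^ k + k
  suc-δ-iter k = begin
    suc (α (iter T k) + β (iter T k))   ≡⟨ sym (+-suc (α (iter T k)) (β (iter T k))) ⟩
    α (iter T k) + suc (β (iter T k))   ≡⟨ cong₂ _+_ (α-iter k) (suc-β-iter k) ⟩
    α T + k + 2 ^ k * suc (β T)         ≡⟨ rearrange (α T) k (2 ^ k) (β T) ⟩
    2 ^ k * β T + α T + 2 ^ k + k       ∎
    where
    rearrange : ∀ a k p b → a + k + p * (1 + b) ≡ p * b + a + p + k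
    rearrange = solve-∀

  g-iter : ∀ k → g (iter T k) ≡ 2 ^ k * g T
  g-iter zero    = sym (*-identityˡ (g T))
  g-iter (suc k) = begin
    g (iter T (suc k))                ≡⟨ g-compound (iter T k) (iter T k) refl ⟩
    g (iter T k) + g (iter T k)       ≡⟨ cong₂ _+_ (g-iter k) (g-iter k) ⟩
    2 ^ k * g T + 2 ^ k * g T         ≡⟨ m*n+m*n≡2*m*n (2 ^ k) (g T) ⟩
    2 ^ suc k * g T                   ∎

  n-iter-pairs : ∀ k → n (iter T k) ≡ 2 ^ k * n T + pairs k * g T ^ 2
  n-iter-pairs zero    = sym (trans (cong (_+ 0) (*-identityˡ (n T))) (+-identityʳ (n T)))
  n-iter-pairs (suc k) = begin
    n (iter T (suc k))
      ≡⟨ n-compound (iter T k) (iter T k) refl ⟩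
    n (iter T k) + (n (iter T k) + g (iter T k) * g (iter T k))
      ≡⟨ cong₂ (λ x y → x + (x + y * y)) (n-iter-pairs k) (g-iter k) ⟩
    p * n T + c * g T ^ 2 + (p * n T + c * g T ^ 2 + p * g T * (p * g T))
      ≡⟨ collect p (n T) c (g T) ⟩
    2 * p * n T + (2 * c + p * p) * g T ^ 2
      ≡⟨ cong (λ x → 2 * p * n T + (2 * c + x) * g T ^ 2) (sym ([m*n]^o≡m^o*n^o 2 2 k)) ⟩
    2 ^ suc k * n T + pairs (suc k) * g T ^ 2 ∎
    where
    p c : ℕ
    p = 2 ^ k
    c = pairs k
    collect : ∀ x y z w → x * y + z * (w * (w * 1)) + (x * y + z * (w * (w * 1)) + x * w * (x * w))
                        ≡ 2 * x * y + (2 * z + x * x) * (w * (w * 1))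
    collect = solve-∀

  β-iter : ∀ k → β (iter T k) ≡ 2 ^ k * β T + 2 ^ k ∸ 1
  β-iter k = cong (_∸ 1) (begin
    suc (β (iter T k))      ≡⟨ suc-β-iter k ⟩
    2 ^ k * suc (β T)       ≡⟨ *-suc (2 ^ k) (β T) ⟩
    2 ^ k + 2 ^ k * β T     ≡⟨ +-comm (2 ^ k) (2 ^ k * β T) ⟩
    2 ^ k * β T + 2 ^ k     ∎)

  δ-iter : ∀ k → δ (iter T k) ≡ 2 ^ k * β T + α T + 2 ^ k + k ∸ 1
  δ-iter k = cong (_∸ 1) (suc-δ-iter k)

  δ-iter′ : ∀ k → δ (iter T k) ≡ 2 ^ k * δ T ∸ (2 ^ k ∸ 1) * α T + 2 ^ k + k ∸ 1
  δ-iter′ k = trans (δ-iter k) (cong (λ x → x + 2 ^ k + k ∸ 1)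
    (sym (m*[n+o]∸[m∸1]*n≡m*o+n (2 ^ k) (α T) (β T) {{m^n≢0 2 k}})))

  n-iter : ∀ k → n (iter T k) ≡ 2 ^ k * n T + ((4 ^ k ∸ 2 ^ k) / 2) * g T ^ 2
  n-iter k = trans (n-iter-pairs k) (cong (λ c → 2 ^ k * n T + c * g T ^ 2) (pairs≡[4^k∸2^k]/2 k))

  g≡β+1⇒g-iter≡β-iter+1 : g T ≡ β T + 1 → ∀ k → g (iter T k) ≡ β (iter T k) + 1
  g≡β+1⇒g-iter≡β-iter+1 g≡β+1 k = begin
    g (iter T k)           ≡⟨ g-iter k ⟩
    2 ^ k * g T            ≡⟨ cong (2 ^ k *_) (trans g≡β+1 (+-comm (β T) 1)) ⟩
    2 ^ k * suc (β T)      ≡⟨ sym (suc-β-iter k) ⟩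
    suc (β (iter T k))     ≡⟨ +-comm 1 (β (iter T k)) ⟩
    β (iter T k) + 1       ∎

proposition5 : (T : Triple) → Nice T →
    (∀ (k : ℕ) →
        (α (iter T k) ≡ α T + k)
      × (β (iter T k) ≡ 2 ^ k * β T + 2 ^ k ∸ 1)
      × (δ (iter T k) ≡ 2 ^ k * β T + α T + 2 ^ k + k ∸ 1)
      × (δ (iter T k) ≡ 2 ^ k * δ T ∸ (2 ^ k ∸ 1) * α T + 2 ^ k + k ∸ 1)
      × (g (iter T k) ≡ 2 ^ k * g T)
      × (n (iter T k) ≡ 2 ^ k * n T + ((4 ^ k ∸ 2 ^ k) / 2) * g T ^ 2))
    × (g T ≡ β T + 1 → ∀ (k : ℕ) → g (iter T k) ≡ β (iter T k) + 1)
proposition5 T _ =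
    (λ k → α-iter T k , β-iter T k , δ-iter T k , δ-iter′ T k , g-iter T k , n-iter T k)
  , g≡β+1⇒g-iter≡β-iter+1 T
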